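{- Let $\Gamma$ be a finite group and let $k$ be a positive integer. If $(\vec T,\gamma)$ is a directed $\Gamma$-labelled graph where $T$ is a subcubic $A$-tree with $\ell(T)\ge(2k-1)|\Gamma|+1$ leaves, then $(\vec T,\gamma)$ contains $k$ pairwise vertex-disjoint $\Gamma$-zero $A$-paths.
   Context: Groups are written additively. A directed $\Gamma$-labelled graph is $(\vec G,\gamma)$ with $\vec G$ an orientation of a graph $G$ and $\gamma:E(G)\to\Gamma$; the weight of a walk $v_0e_1v_1\dots e_mv_m$ is $\gamma(e_1,v_1)+\dots+\gamma(e_m,v_m)$, where for $e$ oriented from $u$ to $v$, $\gamma(e,v)=\gamma(e)$ and $\gamma(e,u)=-\gamma(e)$; a path is $\Gamma$-zero if its weight is $0$. An $A$-path is a path with at least one edge meeting $A$ exactly in its endpoints. An $A$-tree is a tree whose intersection with $A$ is exactly its set of leaves; $\ell(T)$ denotes the number of leaves of $T$; subcubic means maximum degree at most $3$. -}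

module Defs where

open import Level using (Level; _⊔_)
open import Algebra.Bundles using (Group)
open import Data.Nat using (ℕ; zero; suc; _≤_)
open import Data.Fin using (Fin; _≟_)
open import Data.List using (List; []; _∷_; length; filter; allFin)
open import Data.List.Membership.Propositional using (_∈_)
open import Data.List.Relation.Unary.Unique.Propositional using (Unique)
open import Data.List.Relation.Unary.All using (All)
open import Data.List.Relation.Binary.Disjoint.Propositional using (Disjoint)
open import Data.Product using (Σ; _×_)
open import Data.Sum using (_⊎_)
open import Relation.Nullary.Decidable using (_⊎-dec_)
open import Relation.Binary.PropositionalEquality using (_≡_; _≢_)
open import Relation.Nullary using (¬_)

-- Finite groups (written additively in the paper; here the stdlib's
-- multiplicative notation _∙_, ε, _⁻¹ is used).  |Γ| = order.

record FiniteGroup (c ℓ : Level) : Set (Level.suc (c ⊔ ℓ)) where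
  field
    group : Group c ℓ
  open Group group public
  field
    order     : ℕ
    enum      : Fin order → Carrier
    enum-surj : ∀ x → Σ (Fin order) λ i → enum i ≈ x
    enum-inj  : ∀ i j → enum i ≈ enum j → i ≡ j

record Digraph (N M : ℕ) : Set where
  field
    tail head : Fin M → Fin N

module _ {N M : ℕ} (D : Digraph N M) where
  open Digraph D

  data Walk : Fin N → Fin N → Set where
    nil : ∀ {v} → Walk v v
    fwd : ∀ {w} (e : Fin M) → Walk (head e) w → Walk (tail e) w
    bwd : ∀ {w} (e : Fin M) → Walk (tail e) w → Walk (head e) w

  verts : ∀ {u w} → Walk u w → List (Fin N)
  verts {u} nil = u ∷ []
  verts (fwd e p) = Digraph.tail D e ∷ verts p
  verts (bwd e p) = Digraph.head D e ∷ verts p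

  startVerts : ∀ {u w} → Walk u w → List (Fin N)
  startVerts nil = []
  startVerts (fwd e p) = Digraph.tail D e ∷ startVerts p
  startVerts (bwd e p) = Digraph.head D e ∷ startVerts p

  edges : ∀ {u w} → Walk u w → List (Fin M)
  edges nil = []
  edges (fwd e p) = e ∷ edges p
  edges (bwd e p) = e ∷ edges p

  len : ∀ {u w} → Walk u w → ℕ
  len p = length (edges p)

  IsPath : ∀ {u w} → Walk u w → Set
  IsPath p = Unique (verts p)

  IsCycle : ∀ {v} → Walk v v → Set
  IsCycle p = 1 ≤ len p × Unique (edges p) × Unique (startVerts p)

  Connected : Set
  Connected = ∀ u v → Walk u v

  Acyclic : Set
  Acyclic = ∀ v (p : Walk v v) → ¬ IsCycle p

  IsTree : Set
  IsTree = 1 ≤ N × Connected × Acyclic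

  incident? : (v : Fin N) (e : Fin M) → _
  incident? v e = (tail e ≟ v) ⊎-dec (head e ≟ v)

  degree : Fin N → ℕ
  degree v = length (filter (incident? v) (allFin M))

  IsLeaf : Fin N → Set
  IsLeaf v = degree v ≡ 1

  leaves : List (Fin N)
  leaves = filter (λ v → degree v Data.Nat.≟ 1) (allFin N)

  numLeaves : ℕ
  numLeaves = length leaves

  Subcubic : Set
  Subcubic = ∀ v → degree v ≤ 3

  IsATree : (A : Fin N → Set) → Set
  IsATree A = IsTree × (∀ v → (A v → IsLeaf v) × (IsLeaf v → A v))

  IsAPath : (A : Fin N → Set) → ∀ {u w} → Walk u w → Set
  IsAPath A {u} {w} p =
    IsPath p × 1 ≤ len p × A u × A w
    × All (λ x → A x → x ≡ u ⊎ x ≡ w) (verts p)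

module _ {c ℓ : Level} (Γ : FiniteGroup c ℓ) {N M : ℕ} (D : Digraph N M)
         (γ : Fin M → FiniteGroup.Carrier Γ) where
  open FiniteGroup Γ

  -- weight: γ(e₁,v₁) + ... + γ(eₘ,vₘ), with γ(e,head)=γ(e), γ(e,tail)=-γ(e)
  weight : ∀ {u w} → Walk D u w → Carrier
  weight nil = ε
  weight (fwd e p) = γ e ∙ weight p
  weight (bwd e p) = γ e ⁻¹ ∙ weight p

  IsZero : ∀ {u w} → Walk D u w → Set ℓ
  IsZero p = weight p ≈ ε

record SomeWalk {N M : ℕ} (D : Digraph N M) : Set where
  constructor walk
  field
    {start} {end} : Fin N
    path : Walk D start end

-- Root T at a leaf r and give every vertex the weight of its tree path to r as a potential.
-- If two leaves below a vertex v have the same potential, going up from one to their lowest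
-- common ancestor and down to the other is a Γ-zero path. Greedily take a deepest vertex v with
-- more than |Γ| free leaves below it: pigeonhole gives a Γ-zero A-path in its subtree, and since
-- T is subcubic and r is a leaf, v has at most two children, each with at most |Γ| free leaves,
-- so discarding the subtree of v costs at most 2|Γ| leaves. Hence (2k-1)|Γ|+1 leaves allow k
-- rounds.
module Submission where

open import Defs
open import Level using (Level)
open import Data.Nat using (ℕ; _≤_; _*_; _+_; _∸_)
open import Data.Nat using (zero; suc; _<_; z≤n; s≤s; s≤s⁻¹; _≤?_; _<?_; >-nonZero⁻¹)
  renaming (_≟_ to _≟ℕ_)
open import Data.Fin using (Fin; _≟_)
open import Data.Product using (Σ; _×_; ∃; ∃₂; _,_; proj₁; proj₂)
open import Data.List.Relation.Binary.Disjoint.Propositional using (Disjoint)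
open import Relation.Binary.PropositionalEquality using (_≢_)
open import Data.Nat.Properties
  using (≤-refl; ≤-reflexive; ≤-trans; <⇒≤; <⇒≢; ≤-<-trans; <-≤-trans; <-irrefl; <-asym; ≰⇒>; ≮⇒≥;
         +-suc; +-comm; +-identityʳ; +-mono-≤; +-monoˡ-≤; +-monoʳ-≤; +-monoˡ-<; +-cancelʳ-<; +-cancelˡ-<;
         m≤m+n; m≤n+m; *-monoˡ-≤)
open import Data.Nat.Tactic.RingSolver using (solve-∀)
open import Data.Nat.Induction using (<-wellFounded)
open import Induction.WellFounded using (Acc; acc)
import Data.Fin.Properties as Fin
import Data.Product
open import Data.Sum using (_⊎_; inj₁; inj₂; [_,_]′)
import Data.Empty.Irrelevant as Irr
open import Function using (_∘_; id)
open import Data.List using (List; []; _∷_; [_]; _∷ʳ_; _++_; length; filter; reverse; allFin; lookup)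
open import Data.List.Properties using (length-++; ++-assoc; unfold-reverse)
open import Data.List.Extrema.Nat using (argmax; argmax-all; f[xs]≤f[argmax])
open import Data.List.Membership.Propositional using (_∈_; lose)
open import Data.List.Membership.Propositional.Properties
  using (∈-∃++; ∈-++⁻; ∈-++⁺ˡ; ∈-++⁺ʳ; ∈-filter⁺; ∈-filter⁻; ∈-allFin; ∈-lookup)
open import Data.List.Relation.Binary.Subset.Propositional using (_⊆_)
open import Data.List.Relation.Unary.Any as Any using (Any; here; there; any?)
import Data.List.Relation.Unary.Any.Properties as Anyₚ
open import Data.List.Relation.Unary.All as All using (All; []; _∷_)
import Data.List.Relation.Unary.All.Properties as Allₚ
open import Data.List.Relation.Unary.AllPairs using ([]; _∷_)
open import Data.List.Relation.Unary.Unique.Propositional using (Unique)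
import Data.List.Relation.Unary.Unique.Propositional.Properties as Uniqueₚ
open import Relation.Nullary using (¬_; ¬?; Dec; yes; no; contradiction)
open import Relation.Nullary.Decidable as Dec using (_⊎-dec_; _×-dec_)
open import Relation.Unary using (Pred; Decidable)
open import Relation.Binary.PropositionalEquality
  using (_≡_; refl; sym; trans; cong; subst; module ≡-Reasoning)
import Relation.Binary.PropositionalEquality as ≡

private variable
  a p q t : Level
  A : Set a

Unique-++⁻ˡ : ∀ (xs : List A) {ys} → Unique (xs ++ ys) → Unique xs
Unique-++⁻ˡ []       _          = []
Unique-++⁻ˡ (x ∷ xs) (x∉ ∷ xs!) = Allₚ.++⁻ˡ xs x∉ ∷ Unique-++⁻ˡ xs xs!

Unique-reverse : ∀ {xs : List A} → Unique xs → Unique (reverse xs)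
Unique-reverse {A = A} {xs} = Unique-resp-↭ (↭-sym (↭-reverse xs))
  where
  open import Data.List.Relation.Binary.Permutation.Setoid (≡.setoid A) using (↭-sym)
  open import Data.List.Relation.Binary.Permutation.Setoid.Properties (≡.setoid A)
    using (Unique-resp-↭; ↭-reverse)

Unique-⊆⇒length≤ : ∀ {xs ys : List A} → Unique xs → xs ⊆ ys → length xs ≤ length ys
Unique-⊆⇒length≤ {xs = []} _ _ = z≤n
Unique-⊆⇒length≤ {xs = x ∷ xs} (x∉xs ∷ xs!) xs⊆ys
  with ys₁ , ys₂ , refl ← ∈-∃++ (xs⊆ys (here refl)) = begin
    suc (length xs)                   ≤⟨ s≤s (Unique-⊆⇒length≤ xs! xs⊆ys₁++ys₂) ⟩
    suc (length (ys₁ ++ ys₂))         ≡⟨ cong suc (length-++ ys₁) ⟩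
    suc (length ys₁ + length ys₂)     ≡⟨ +-suc (length ys₁) _ ⟨
    length ys₁ + length (x ∷ ys₂)     ≡⟨ length-++ ys₁ ⟨
    length (ys₁ ++ x ∷ ys₂)           ∎
  where
  open Data.Nat.Properties.≤-Reasoning
  xs⊆ys₁++ys₂ : xs ⊆ ys₁ ++ ys₂
  xs⊆ys₁++ys₂ {y} y∈xs with ∈-++⁻ ys₁ (xs⊆ys (there y∈xs))
  ... | inj₁ y∈ys₁         = ∈-++⁺ˡ y∈ys₁
  ... | inj₂ (here refl)   = contradiction y∈xs (Allₚ.All¬⇒¬Any x∉xs)
  ... | inj₂ (there y∈ys₂) = ∈-++⁺ʳ ys₁ y∈ys₂

lookup-injective : ∀ {xs : List A} → Unique xs → ∀ i j → lookup xs i ≡ lookup xs j → i ≡ j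
lookup-injective {xs = _ ∷ _} _ Fin.zero Fin.zero _ = refl
lookup-injective {xs = _ ∷ xs} (x∉xs ∷ _) Fin.zero (Fin.suc j) x≡xsⱼ =
  contradiction (subst (_∈ xs) (sym x≡xsⱼ) (∈-lookup j)) (Allₚ.All¬⇒¬Any x∉xs)
lookup-injective {xs = _ ∷ xs} (x∉xs ∷ _) (Fin.suc i) Fin.zero xsᵢ≡x =
  contradiction (subst (_∈ xs) xsᵢ≡x (∈-lookup i)) (Allₚ.All¬⇒¬Any x∉xs)
lookup-injective (_ ∷ xs!) (Fin.suc i) (Fin.suc j) eq = cong Fin.suc (lookup-injective xs! i j eq)

pigeonhole : ∀ {m} {xs : List A} → Unique xs → m < length xs → (f : A → Fin m) →
  ∃₂ λ x y → x ∈ xs × y ∈ xs × x ≢ y × f x ≡ f y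
pigeonhole {xs = xs} xs! m<|xs| f
  with i , j , i<j , fᵢ≡fⱼ ← Fin.pigeonhole m<|xs| (λ i → f (lookup xs i)) =
  lookup xs i , lookup xs j , ∈-lookup i , ∈-lookup j ,
  (λ xsᵢ≡xsⱼ → Fin.<⇒≢ i<j (lookup-injective xs! i j xsᵢ≡xsⱼ)) , fᵢ≡fⱼ

module _ {n : ℕ} where

  count : {P : Pred (Fin n) p} → Decidable P → ℕ
  count P? = length (filter P? (allFin n))

  module _ {P : Pred (Fin n) p} (P? : Decidable P) where

    Unique-filter-allFin : Unique (filter P? (allFin n))
    Unique-filter-allFin = Uniqueₚ.filter⁺ P? (Uniqueₚ.allFin⁺ n)

    ∈-filter-allFin : ∀ {x} → P x → x ∈ filter P? (allFin n)
    ∈-filter-allFin = ∈-filter⁺ P? (∈-allFin _)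

    ∈-filter-allFin⁻ : ∀ {x} → x ∈ filter P? (allFin n) → P x
    ∈-filter-allFin⁻ x∈ = proj₂ (∈-filter⁻ P? {xs = allFin n} x∈)

    count-witness : 1 ≤ count P? → ∃ P
    count-witness 1≤count with filter P? (allFin n) in eq
    ... | x ∷ _ = x , ∈-filter-allFin⁻ (subst (x ∈_) (sym eq) (here refl))

    count-⊆ : ∀ {xs} → (∀ {x} → P x → x ∈ xs) → count P? ≤ length xs
    count-⊆ P⊆xs = Unique-⊆⇒length≤ Unique-filter-allFin (P⊆xs ∘ ∈-filter-allFin⁻)

  module _ {P : Pred (Fin n) p} {Q : Pred (Fin n) q} (P? : Decidable P) (Q? : Decidable Q) where

    count-mono : (∀ {x} → P x → Q x) → count P? ≤ count Q?
    count-mono P⇒Q = count-⊆ P? (∈-filter-allFin Q? ∘ P⇒Q)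

    count-∪ : ∀ {R : Pred (Fin n) t} (R? : Decidable R) → (∀ {x} → P x → Q x ⊎ R x) →
      count P? ≤ count Q? + count R?
    count-∪ R? P⇒Q∪R = ≤-trans
      (count-⊆ P? ([ ∈-++⁺ˡ ∘ ∈-filter-allFin Q? , ∈-++⁺ʳ _ ∘ ∈-filter-allFin R? ]′ ∘ P⇒Q∪R))
      (≤-reflexive (length-++ (filter Q? (allFin n))))

  count-⋃ : ∀ {P : Pred (Fin n) p} (P? : Decidable P) {Q : A → Pred (Fin n) q}
    (Q? : ∀ c → Decidable (Q c)) {g} cs → All (λ c → count (Q? c) ≤ g) cs →
    (∀ {x} → P x → Any (λ c → Q c x) cs) → count P? ≤ length cs * g
  count-⋃ P? Q? [] [] P⊆⋃ = count-⊆ P? {xs = []} (λ Px → contradiction (P⊆⋃ Px) λ ())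
  count-⋃ P? {Q} Q? {g} (c ∷ cs) (Qc≤g ∷ Qcs≤g) P⊆⋃ = begin
    count P?                            ≤⟨ count-∪ P? (Q? c) ⋃cs? (Any.toSum ∘ P⊆⋃) ⟩
    count (Q? c) + count ⋃cs?           ≤⟨ +-mono-≤ Qc≤g (count-⋃ ⋃cs? Q? cs Qcs≤g id) ⟩
    g + length cs * g                   ∎
    where
    open Data.Nat.Properties.≤-Reasoning
    ⋃cs? : Decidable (λ x → Any (λ c → Q c x) cs)
    ⋃cs? x = any? (λ c → Q? c x) cs

module _ {b} {B : Set b} {P : Pred A p} (f : ∀ {x} → P x → B) where

  length-reduce : ∀ {xs} (pxs : All P xs) → length (All.reduce f pxs) ≡ length xs
  length-reduce []         = refl
  length-reduce (px ∷ pxs) = cong suc (length-reduce pxs)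

  All-reduce : ∀ {Q : Pred B q} → (∀ {x} (px : P x) → Q (f px)) →
    ∀ {xs} (pxs : All P xs) → All Q (All.reduce f pxs)
  All-reduce Qf []         = []
  All-reduce Qf (px ∷ pxs) = Qf px ∷ All-reduce Qf pxs

least : ∀ {P : Pred ℕ p} → Decidable P → ∀ {n} → P n → ∃ λ m → P m × (∀ {k} → k < m → ¬ P k)
least P? {zero} P0 = 0 , P0 , λ ()
least P? {suc n} Pn with P? 0
... | yes P0 = 0 , P0 , λ ()
... | no ¬P0 with m , Pm , below ← least (P? ∘ suc) Pn =
  suc m , Pm , λ { {zero} _ → ¬P0 ; {suc k} (s≤s k<m) → below k<m }

module _ {N M : ℕ} {D : Digraph N M} where
  open Digraph D

  infixr 5 _++ʷ_

  _++ʷ_ : ∀ {u v w} → Walk D u v → Walk D v w → Walk D u w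
  nil     ++ʷ q = q
  fwd e p ++ʷ q = fwd e (p ++ʷ q)
  bwd e p ++ʷ q = bwd e (p ++ʷ q)

  reverseʷ : ∀ {u v} → Walk D u v → Walk D v u
  reverseʷ nil       = nil
  reverseʷ (fwd e p) = reverseʷ p ++ʷ bwd e nil
  reverseʷ (bwd e p) = reverseʷ p ++ʷ fwd e nil

  ++ʷ-assoc : ∀ {u v w x} (p : Walk D u v) (q : Walk D v w) (s : Walk D w x) →
    (p ++ʷ q) ++ʷ s ≡ p ++ʷ (q ++ʷ s)
  ++ʷ-assoc nil       q s = refl
  ++ʷ-assoc (fwd e p) q s = cong (fwd e) (++ʷ-assoc p q s)
  ++ʷ-assoc (bwd e p) q s = cong (bwd e) (++ʷ-assoc p q s)

  verts-++ʷ : ∀ {u v w} (p : Walk D u v) (q : Walk D v w) →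
    verts D (p ++ʷ q) ≡ startVerts D p ++ verts D q
  verts-++ʷ nil       q = refl
  verts-++ʷ (fwd e p) q = cong (tail e ∷_) (verts-++ʷ p q)
  verts-++ʷ (bwd e p) q = cong (head e ∷_) (verts-++ʷ p q)

  verts≡startVerts∷ʳ : ∀ {u w} (p : Walk D u w) → verts D p ≡ startVerts D p ∷ʳ w
  verts≡startVerts∷ʳ nil       = refl
  verts≡startVerts∷ʳ (fwd e p) = cong (tail e ∷_) (verts≡startVerts∷ʳ p)
  verts≡startVerts∷ʳ (bwd e p) = cong (head e ∷_) (verts≡startVerts∷ʳ p)

  verts-++ʷ-step : ∀ {u v x} (p : Walk D u v) (s : Walk D v x) → verts D s ≡ v ∷ [ x ] →
    verts D (p ++ʷ s) ≡ verts D p ∷ʳ x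
  verts-++ʷ-step {v = v} {x} p s verts-s = begin
    verts D (p ++ʷ s)              ≡⟨ verts-++ʷ p s ⟩
    startVerts D p ++ verts D s    ≡⟨ cong (startVerts D p ++_) verts-s ⟩
    startVerts D p ++ v ∷ [ x ]    ≡⟨ ++-assoc (startVerts D p) [ v ] [ x ] ⟨
    (startVerts D p ∷ʳ v) ∷ʳ x     ≡⟨ cong (_∷ʳ x) (verts≡startVerts∷ʳ p) ⟨
    verts D p ∷ʳ x                 ∎
    where open ≡-Reasoning

  verts-reverseʷ : ∀ {u w} (p : Walk D u w) → verts D (reverseʷ p) ≡ reverse (verts D p)
  verts-reverseʷ nil       = refl
  verts-reverseʷ (fwd e p) = begin
    verts D (reverseʷ p ++ʷ bwd e nil)  ≡⟨ verts-++ʷ-step (reverseʷ p) (bwd e nil) refl ⟩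
    verts D (reverseʷ p) ∷ʳ tail e      ≡⟨ cong (_∷ʳ tail e) (verts-reverseʷ p) ⟩
    reverse (verts D p) ∷ʳ tail e       ≡⟨ unfold-reverse (tail e) (verts D p) ⟨
    reverse (tail e ∷ verts D p)        ∎
    where open ≡-Reasoning
  verts-reverseʷ (bwd e p) = begin
    verts D (reverseʷ p ++ʷ fwd e nil)  ≡⟨ verts-++ʷ-step (reverseʷ p) (fwd e nil) refl ⟩
    verts D (reverseʷ p) ∷ʳ head e      ≡⟨ cong (_∷ʳ head e) (verts-reverseʷ p) ⟩
    reverse (verts D p) ∷ʳ head e       ≡⟨ unfold-reverse (head e) (verts D p) ⟨
    reverse (head e ∷ verts D p)        ∎
    where open ≡-Reasoning

  start∈verts : ∀ {u w} (p : Walk D u w) → u ∈ verts D p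
  start∈verts nil       = here refl
  start∈verts (fwd e p) = here refl
  start∈verts (bwd e p) = here refl

  1≤len : ∀ {u w} (p : Walk D u w) → u ≢ w → 1 ≤ len D p
  1≤len nil       u≢u = contradiction refl u≢u
  1≤len (fwd e p) _   = s≤s z≤n
  1≤len (bwd e p) _   = s≤s z≤n

module _ {N M : ℕ} {D : Digraph N M} {u w : Fin N} (p : Walk D u w) where

  All-startVerts : ∀ {P : Pred (Fin N) q} → All P (verts D p) → All P (startVerts D p)
  All-startVerts Pverts = Allₚ.++⁻ˡ (startVerts D p) (subst (All _) (verts≡startVerts∷ʳ p) Pverts)

  Unique-startVerts : IsPath D p → Unique (startVerts D p)
  Unique-startVerts p! = Unique-++⁻ˡ (startVerts D p) (subst Unique (verts≡startVerts∷ʳ p) p!)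

data Joins {N M} (D : Digraph N M) (e : Fin M) (x y : Fin N) : Set where
  forwards  : Digraph.tail D e ≡ x → Digraph.head D e ≡ y → Joins D e x y
  backwards : Digraph.head D e ≡ x → Digraph.tail D e ≡ y → Joins D e x y

Incident : ∀ {N M} → Digraph N M → Fin N → Fin M → Set
Incident D v e = Digraph.tail D e ≡ v ⊎ Digraph.head D e ≡ v

module _ {N M : ℕ} {D : Digraph N M} {e : Fin M} where
  open Digraph D

  Joins-sym : ∀ {x y} → Joins D e x y → Joins D e y x
  Joins-sym (forwards t≡x h≡y)  = backwards h≡y t≡x
  Joins-sym (backwards h≡x t≡y) = forwards t≡y h≡x

  Joins⇒Incident : ∀ {x y} → Joins D e x y → Incident D x e
  Joins⇒Incident (forwards t≡x _)  = inj₁ t≡x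
  Joins⇒Incident (backwards h≡x _) = inj₂ h≡x

  Joins-other-end : ∀ {x y z} → Joins D e x y → Joins D e x z → x ≢ y → y ≡ z
  Joins-other-end (forwards _ h≡y)   (forwards _ h≡z)   _   = trans (sym h≡y) h≡z
  Joins-other-end (forwards _ h≡y)   (backwards h≡x _)  x≢y = contradiction (trans (sym h≡x) h≡y) x≢y
  Joins-other-end (backwards _ t≡y)  (forwards t≡x _)   x≢y = contradiction (trans (sym t≡x) t≡y) x≢y
  Joins-other-end (backwards _ t≡y)  (backwards _ t≡z)  _   = trans (sym t≡y) t≡z

  edgeWalk : ∀ {x y} → Joins D e x y → Walk D x y
  edgeWalk (forwards refl refl)  = fwd e nil
  edgeWalk (backwards refl refl) = bwd e nil

  verts-edgeWalk-++ʷ : ∀ {x y w} (j : Joins D e x y) (q : Walk D y w) →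
    verts D (edgeWalk j ++ʷ q) ≡ x ∷ verts D q
  verts-edgeWalk-++ʷ (forwards refl refl)  q = refl
  verts-edgeWalk-++ʷ (backwards refl refl) q = refl

  startVerts-edgeWalk-++ʷ : ∀ {x y w} (j : Joins D e x y) (q : Walk D y w) →
    startVerts D (edgeWalk j ++ʷ q) ≡ x ∷ startVerts D q
  startVerts-edgeWalk-++ʷ (forwards refl refl)  q = refl
  startVerts-edgeWalk-++ʷ (backwards refl refl) q = refl

module _ {N M : ℕ} {D : Digraph N M} where
  open Digraph D

  incident-edges≤degree : ∀ v {es} → Unique es → All (Incident D v) es → length es ≤ degree D v
  incident-edges≤degree v es! incident =
    Unique-⊆⇒length≤ es! (∈-filter-allFin (incident? D v) ∘ All.lookup incident)

  second-vertex-degree : ∀ {e t y w} → Joins D e t y → (q : Walk D y w) →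
    All (t ≢_) (verts D q) → y ≡ w ⊎ 2 ≤ degree D y
  second-vertex-degree j nil _ = inj₁ refl
  second-vertex-degree {e} j (fwd f q) (t≢y ∷ t∉q) =
    inj₂ (incident-edges≤degree _ ((e≢f ∷ []) ∷ [] ∷ [])
                                  (Joins⇒Incident (Joins-sym j) ∷ inj₁ refl ∷ []))
    where
    e≢f : e ≢ f
    e≢f refl = All.lookup t∉q (start∈verts q)
      (Joins-other-end (Joins-sym j) (forwards refl refl) (t≢y ∘ sym))
  second-vertex-degree {e} j (bwd f q) (t≢y ∷ t∉q) =
    inj₂ (incident-edges≤degree _ ((e≢f ∷ []) ∷ [] ∷ [])
                                  (Joins⇒Incident (Joins-sym j) ∷ inj₂ refl ∷ []))
    where
    e≢f : e ≢ f
    e≢f refl = All.lookup t∉q (start∈verts q)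
      (Joins-other-end (Joins-sym j) (backwards refl refl) (t≢y ∘ sym))

  private
    pass-endpoint : ∀ {u y w x} → y ≡ w ⊎ 2 ≤ degree D y →
      x ≡ y ⊎ x ≡ w ⊎ 2 ≤ degree D x → x ≡ u ⊎ x ≡ w ⊎ 2 ≤ degree D x
    pass-endpoint y-ok (inj₁ refl) = inj₂ y-ok
    pass-endpoint _    (inj₂ x-ok) = inj₂ x-ok

  path-interior-degree : ∀ {u w} (p : Walk D u w) → IsPath D p →
    All (λ x → x ≡ u ⊎ x ≡ w ⊎ 2 ≤ degree D x) (verts D p)
  path-interior-degree nil _ = inj₁ refl ∷ []
  path-interior-degree (fwd e q) (t∉q ∷ q!) = inj₁ refl ∷
    All.map (pass-endpoint (second-vertex-degree (forwards refl refl) q t∉q)) (path-interior-degree q q!)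
  path-interior-degree (bwd e q) (h∉q ∷ q!) = inj₁ refl ∷
    All.map (pass-endpoint (second-vertex-degree (backwards refl refl) q h∉q)) (path-interior-degree q q!)

module _ {c ℓ : Level} (Γ : FiniteGroup c ℓ) {N M : ℕ} {D : Digraph N M}
         (γ : Fin M → FiniteGroup.Carrier Γ) where
  open FiniteGroup Γ renaming (sym to ≈-sym; trans to ≈-trans)
  open import Relation.Binary.Reasoning.Setoid setoid
  open import Algebra.Properties.Group group using (ε⁻¹≈ε; ⁻¹-anti-homo-∙; ⁻¹-involutive)

  weight-++ʷ : ∀ {u v w} (p : Walk D u v) (q : Walk D v w) →
    weight Γ D γ (p ++ʷ q) ≈ weight Γ D γ p ∙ weight Γ D γ q
  weight-++ʷ nil       q = ≈-sym (identityˡ _)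
  weight-++ʷ (fwd e p) q = ≈-trans (∙-congˡ (weight-++ʷ p q)) (≈-sym (assoc _ _ _))
  weight-++ʷ (bwd e p) q = ≈-trans (∙-congˡ (weight-++ʷ p q)) (≈-sym (assoc _ _ _))

  weight-reverseʷ : ∀ {u w} (p : Walk D u w) → weight Γ D γ (reverseʷ p) ≈ weight Γ D γ p ⁻¹
  weight-reverseʷ nil       = ≈-sym ε⁻¹≈ε
  weight-reverseʷ (fwd e p) = begin
    weight Γ D γ (reverseʷ p ++ʷ bwd e nil)  ≈⟨ weight-++ʷ (reverseʷ p) (bwd e nil) ⟩
    weight Γ D γ (reverseʷ p) ∙ (γ e ⁻¹ ∙ ε) ≈⟨ ∙-cong (weight-reverseʷ p) (identityʳ _) ⟩
    weight Γ D γ p ⁻¹ ∙ γ e ⁻¹               ≈⟨ ⁻¹-anti-homo-∙ (γ e) (weight Γ D γ p) ⟨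
    (γ e ∙ weight Γ D γ p) ⁻¹                ∎
  weight-reverseʷ (bwd e p) = begin
    weight Γ D γ (reverseʷ p ++ʷ fwd e nil)  ≈⟨ weight-++ʷ (reverseʷ p) (fwd e nil) ⟩
    weight Γ D γ (reverseʷ p) ∙ (γ e ∙ ε)    ≈⟨ ∙-cong (weight-reverseʷ p) (identityʳ _) ⟩
    weight Γ D γ p ⁻¹ ∙ γ e                  ≈⟨ ∙-congˡ (⁻¹-involutive (γ e)) ⟨
    weight Γ D γ p ⁻¹ ∙ γ e ⁻¹ ⁻¹            ≈⟨ ⁻¹-anti-homo-∙ (γ e ⁻¹) (weight Γ D γ p) ⟨
    (γ e ⁻¹ ∙ weight Γ D γ p) ⁻¹             ∎

module RootedSpanningTree {N M : ℕ} (D : Digraph N M) (connected : Connected D) (r : Fin N) where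
  open Digraph D

  Near : ℕ → Fin N → Set
  Near zero    v = v ≡ r
  Near (suc n) v = Near n v
    ⊎ Any (λ e → (tail e ≡ v × Near n (head e)) ⊎ (head e ≡ v × Near n (tail e))) (allFin M)

  near? : ∀ n → Decidable (Near n)
  near? zero    v = v ≟ r
  near? (suc n) v = near? n v
    ⊎-dec any? (λ e → ((tail e ≟ v) ×-dec near? n (head e)) ⊎-dec ((head e ≟ v) ×-dec near? n (tail e)))
               (allFin M)

  private
    walk-near : ∀ {u v n} → Walk D u v → Near n u → ∃ λ m → Near m v
    walk-near nil       near = _ , near
    walk-near (fwd e p) near = walk-near p (inj₂ (lose (∈-allFin e) (inj₂ (refl , near))))
    walk-near (bwd e p) near = walk-near p (inj₂ (lose (∈-allFin e) (inj₁ (refl , near))))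

    nearest : ∀ v → ∃ λ n → Near n v × (∀ {k} → k < n → ¬ Near k v)
    nearest v = least (λ n → near? n v) (proj₂ (walk-near (connected r v) refl))

  depth : Fin N → ℕ
  depth v = proj₁ (nearest v)

  depth-near : ∀ v → Near (depth v) v
  depth-near v = proj₁ (proj₂ (nearest v))

  depth-least : ∀ v {k} → k < depth v → ¬ Near k v
  depth-least v = proj₂ (proj₂ (nearest v))

  depth-minimal : ∀ {v k} → Near k v → depth v ≤ k
  depth-minimal {v} {k} near with depth v ≤? k
  ... | yes d≤k = d≤k
  ... | no  d≰k = contradiction near (depth-least v (≰⇒> d≰k))

  private
    closer-neighbour : ∀ {v} n → Near n v → (∀ {k} → k < n → ¬ Near k v) → v ≢ r →
      ∃₂ λ u e → Joins D e v u × depth u < n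
    closer-neighbour zero    v≡r     _     v≢r = contradiction v≡r v≢r
    closer-neighbour (suc n) (inj₁ near) below _ = contradiction near (below ≤-refl)
    closer-neighbour (suc n) (inj₂ any) _ _ with Any.satisfied any
    ... | e , inj₁ (t≡v , near) = head e , e , forwards t≡v refl  , s≤s (depth-minimal near)
    ... | e , inj₂ (h≡v , near) = tail e , e , backwards h≡v refl , s≤s (depth-minimal near)

  record ParentEdge (v : Fin N) : Set where
    field
      parent  : Fin N
      edge    : Fin M
      joins   : Joins D edge v parent
      closer  : depth parent < depth v

  -- The non-root hypothesis is irrelevant, so parents and ancestry proofs cannot depend on it;
  -- this is what makes Ancestor-irrelevant below provable.
  parentEdge : ∀ v → .(v ≢ r) → ParentEdge v
  parentEdge v v≢r with v ≟ r
  ... | yes v≡r = Irr.⊥-elim (v≢r v≡r)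
  ... | no  v≢r with u , e , j , u-closer ← closer-neighbour (depth v) (depth-near v) (depth-least v) v≢r =
    record { parent = u ; edge = e ; joins = j ; closer = u-closer }

  parent : ∀ v → .(v ≢ r) → Fin N
  parent v v≢r = ParentEdge.parent (parentEdge v v≢r)

  joins-parent : ∀ v .(v≢r : v ≢ r) → Joins D (ParentEdge.edge (parentEdge v v≢r)) v (parent v v≢r)
  joins-parent v v≢r = ParentEdge.joins (parentEdge v v≢r)

  depth-parent : ∀ v .(v≢r : v ≢ r) → depth (parent v v≢r) < depth v
  depth-parent v v≢r = ParentEdge.closer (parentEdge v v≢r)

  data Ancestor (y : Fin N) : Fin N → Set where
    here : Ancestor y y
    step : ∀ {x} .(x≢r : x ≢ r) → Ancestor y (parent x x≢r) → Ancestor y x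

  Ancestor⇒depth≤ : ∀ {y x} → Ancestor y x → depth y ≤ depth x
  Ancestor⇒depth≤ here           = ≤-refl
  Ancestor⇒depth≤ (step x≢r y≼p) = <⇒≤ (≤-<-trans (Ancestor⇒depth≤ y≼p) (depth-parent _ x≢r))

  Ancestor-trans : ∀ {y m x} → Ancestor m x → Ancestor y m → Ancestor y x
  Ancestor-trans here           y≼m = y≼m
  Ancestor-trans (step x≢r m≼p) y≼m = step x≢r (Ancestor-trans m≼p y≼m)

  ¬Ancestor-of-parent : ∀ {x} .(x≢r : x ≢ r) → ¬ Ancestor x (parent x x≢r)
  ¬Ancestor-of-parent {x} x≢r x≼p = <-irrefl refl (≤-<-trans (Ancestor⇒depth≤ x≼p) (depth-parent x x≢r))

  Ancestor-irrelevant : ∀ {y x} (p q : Ancestor y x) → p ≡ q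
  Ancestor-irrelevant here           here         = refl
  Ancestor-irrelevant here           (step x≢r q) = contradiction q (¬Ancestor-of-parent x≢r)
  Ancestor-irrelevant (step x≢r p)   here         = contradiction p (¬Ancestor-of-parent x≢r)
  Ancestor-irrelevant (step x≢r p)   (step _ q)   = cong (step x≢r) (Ancestor-irrelevant p q)

  root-Ancestor : ∀ x → Ancestor r x
  root-Ancestor x = go x (<-wellFounded (depth x))
    where
    go : ∀ x → Acc _<_ (depth x) → Ancestor r x
    go x (acc rec) with x ≟ r
    ... | yes refl = here
    ... | no  x≢r  = step x≢r (go _ (rec (depth-parent x x≢r)))

  ancestor? : ∀ y x → Dec (Ancestor y x)
  ancestor? y x = go x (<-wellFounded (depth x))
    where
    go : ∀ x → Acc _<_ (depth x) → Dec (Ancestor y x)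
    go x (acc rec) with x ≟ y
    ... | yes refl = yes here
    ... | no  x≢y with x ≟ r
    ...   | yes refl = no λ { here → x≢y refl ; (step r≢r _) → Irr.⊥-elim (r≢r refl) }
    ...   | no  x≢r  = Dec.map′ (step x≢r) (λ { here → contradiction refl x≢y ; (step _ y≼p) → y≼p })
                         (go _ (rec (depth-parent x x≢r)))

  walkUp : ∀ {y x} → Ancestor y x → Walk D x y
  walkUp here           = nil
  walkUp (step x≢r y≼p) = edgeWalk (joins-parent _ x≢r) ++ʷ walkUp y≼p

  walkUp-trans : ∀ {y m x} (m≼x : Ancestor m x) (y≼m : Ancestor y m) →
    walkUp (Ancestor-trans m≼x y≼m) ≡ walkUp m≼x ++ʷ walkUp y≼m
  walkUp-trans here           y≼m = refl
  walkUp-trans (step x≢r m≼p) y≼m = trans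
    (cong (edgeWalk (joins-parent _ x≢r) ++ʷ_) (walkUp-trans m≼p y≼m))
    (sym (++ʷ-assoc (edgeWalk (joins-parent _ x≢r)) (walkUp m≼p) (walkUp y≼m)))

  verts-walkUp : ∀ {y x} (y≼x : Ancestor y x) →
    All (λ z → Ancestor z x × Ancestor y z) (verts D (walkUp y≼x))
  verts-walkUp here           = (here , here) ∷ []
  verts-walkUp (step x≢r y≼p) rewrite verts-edgeWalk-++ʷ (joins-parent _ x≢r) (walkUp y≼p) =
    (here , step x≢r y≼p) ∷ All.map (λ (z≼p , y≼z) → step x≢r z≼p , y≼z) (verts-walkUp y≼p)

  walkUp-isPath : ∀ {y x} (y≼x : Ancestor y x) → IsPath D (walkUp y≼x)
  walkUp-isPath here           = [] ∷ []
  walkUp-isPath (step x≢r y≼p) rewrite verts-edgeWalk-++ʷ (joins-parent _ x≢r) (walkUp y≼p) =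
    All.map (λ (z≼p , _) x≡z → ¬Ancestor-of-parent x≢r (subst (λ z → Ancestor z _) (sym x≡z) z≼p))
            (verts-walkUp y≼p)
    ∷ walkUp-isPath y≼p

  climb : ∀ {Q : Pred (Fin N) p} → Decidable Q → ∀ {z x} → Ancestor z x → Q z →
    ∃ λ m → Q m × Ancestor z m × Σ (Ancestor m x) λ m≼x → All (¬_ ∘ Q) (startVerts D (walkUp m≼x))
  climb Q? {z} here Qz = z , Qz , here , here , []
  climb Q? {x = x} (step x≢r z≼p) Qz with Q? x
  ... | yes Qx = x , Qx , step x≢r z≼p , here , []
  ... | no ¬Qx with m , Qm , z≼m , m≼p , below ← climb Q? z≼p Qz =
    m , Qm , z≼m , step x≢r m≼p ,
    subst (All (¬_ ∘ _)) (sym (startVerts-edgeWalk-++ʷ (joins-parent _ x≢r) (walkUp m≼p)))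
      (¬Qx ∷ below)

  record Child (v c : Fin N) : Set where
    constructor child
    field
      .nonroot : c ≢ r
      parent≡  : parent c nonroot ≡ v

  child? : ∀ v c → Dec (Child v c)
  child? v c with c ≟ r
  ... | yes c≡r = no λ { (child c≢r _) → Irr.⊥-elim (c≢r c≡r) }
  ... | no  c≢r = Dec.map′ (child c≢r) Child.parent≡ (parent c c≢r ≟ v)

  children : Fin N → List (Fin N)
  children v = filter (child? v) (allFin N)

  Child-depth : ∀ {v c} → Child v c → depth v < depth c
  Child-depth (child c≢r refl) = depth-parent _ c≢r

  Ancestor⇒≡⊎below-child : ∀ {v x} → Ancestor v x → x ≡ v ⊎ Any (λ c → Ancestor c x) (children v)
  Ancestor⇒≡⊎below-child here = inj₁ refl
  Ancestor⇒≡⊎below-child (step x≢r v≼p) with Ancestor⇒≡⊎below-child v≼p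
  ... | inj₁ p≡v       = inj₂ (lose (∈-filter-allFin (child? _) (child x≢r p≡v)) here)
  ... | inj₂ below-c   = inj₂ (Any.map (step x≢r) below-c)

  childEdge : ∀ {v c} → Child v c → Fin M
  childEdge (child c≢r _) = ParentEdge.edge (parentEdge _ c≢r)

  childEdge-joins : ∀ {v c} (ch : Child v c) → Joins D (childEdge ch) v c
  childEdge-joins (child c≢r refl) = Joins-sym (joins-parent _ c≢r)

  childEdge-injective : ∀ {v c c′} (ch : Child v c) (ch′ : Child v c′) →
    childEdge ch ≡ childEdge ch′ → c ≡ c′
  childEdge-injective ch ch′ e≡e′ = Joins-other-end (childEdge-joins ch)
    (subst (λ e → Joins D e _ _) (sym e≡e′) (childEdge-joins ch′)) (<⇒≢ (Child-depth ch) ∘ cong depth)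

  childEdge≢parentEdge : ∀ {v c} (ch : Child v c) .(v≢r : v ≢ r) →
    childEdge ch ≢ ParentEdge.edge (parentEdge v v≢r)
  childEdge≢parentEdge {v} ch v≢r e≡e′ = <-asym (Child-depth ch)
    (subst (λ c → depth c < depth v) c≡p (depth-parent v v≢r))
    where
    c≡p : parent v v≢r ≡ _
    c≡p = Joins-other-end (subst (λ e → Joins D e _ _) (sym e≡e′) (joins-parent v v≢r))
            (childEdge-joins ch) (λ v≡p → <-irrefl (cong depth (sym v≡p)) (depth-parent v v≢r))

  private
    childEdges-Unique : ∀ {v cs} (chs : All (Child v) cs) → Unique cs → Unique (All.reduce childEdge chs)
    childEdges-Unique []         []           = []
    childEdges-Unique (ch ∷ chs) (c∉cs ∷ cs!) = distinct chs c∉cs ∷ childEdges-Unique chs cs!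
      where
      distinct : ∀ {cs} (chs : All (Child _) cs) → All (_ ≢_) cs →
        All (childEdge ch ≢_) (All.reduce childEdge chs)
      distinct []          []          = []
      distinct (ch′ ∷ chs) (c≢c′ ∷ c∉) = c≢c′ ∘ childEdge-injective ch ch′ ∷ distinct chs c∉

  children-all : ∀ v → All (Child v) (children v)
  children-all v = Allₚ.all-filter (child? v) (allFin N)

  children-degree : ∀ v → length (children v) ≤ degree D v
  children-degree v = subst (_≤ degree D v) (length-reduce childEdge (children-all v))
    (incident-edges≤degree v (childEdges-Unique (children-all v) (Unique-filter-allFin (child? v)))
      (All-reduce childEdge (Joins⇒Incident ∘ childEdge-joins) (children-all v)))

  nonroot-children-degree : ∀ v → v ≢ r → suc (length (children v)) ≤ degree D v
  nonroot-children-degree v v≢r =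
    subst (λ n → suc n ≤ degree D v) (length-reduce childEdge (children-all v))
      (incident-edges≤degree v
        (All-reduce childEdge (λ ch → childEdge≢parentEdge ch v≢r ∘ sym) (children-all v)
          ∷ childEdges-Unique (children-all v) (Unique-filter-allFin (child? v)))
        (Joins⇒Incident (joins-parent v v≢r)
          ∷ All-reduce childEdge (Joins⇒Incident ∘ childEdge-joins) (children-all v)))

  module _ {c ℓ : Level} (Γ : FiniteGroup c ℓ) (γ : Fin M → FiniteGroup.Carrier Γ) where
    open FiniteGroup Γ renaming (sym to ≈-sym; trans to ≈-trans)
    open import Relation.Binary.Reasoning.Setoid setoid
    open import Algebra.Properties.Group group using (∙-cancelʳ)

    private
      wt : ∀ {u w} → Walk D u w → Carrier
      wt = weight Γ D γ

    potential : Fin N → Carrier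
    potential x = wt (walkUp (root-Ancestor x))

    potential-Ancestor : ∀ {y x} (y≼x : Ancestor y x) → potential x ≈ wt (walkUp y≼x) ∙ potential y
    potential-Ancestor {y} {x} y≼x = begin
      wt (walkUp (root-Ancestor x))
        ≡⟨ cong (wt ∘ walkUp) (Ancestor-irrelevant (root-Ancestor x) (Ancestor-trans y≼x (root-Ancestor y))) ⟩
      wt (walkUp (Ancestor-trans y≼x (root-Ancestor y)))
        ≡⟨ cong wt (walkUp-trans y≼x (root-Ancestor y)) ⟩
      wt (walkUp y≼x ++ʷ walkUp (root-Ancestor y))
        ≈⟨ weight-++ʷ Γ γ (walkUp y≼x) (walkUp (root-Ancestor y)) ⟩
      wt (walkUp y≼x) ∙ potential y
        ∎

    -- m, the first ancestor of a that is also an ancestor of b, is their lowest common ancestor, so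
    -- going up from a to m and down to b is a path; equal potentials give its halves equal weight.
    zero-path : ∀ {v a b} → Ancestor v a → Ancestor v b → potential a ≈ potential b →
      Σ (Walk D a b) λ W → IsPath D W × IsZero Γ D γ W
        × All (λ y → Ancestor v y × (Ancestor y a ⊎ Ancestor y b)) (verts D W)
    zero-path {v} {a} {b} v≼a v≼b same
      with m , m≼b , v≼m , m≼a , not-below-b ← climb (λ y → ancestor? y b) v≼a v≼b =
      up ++ʷ reverseʷ down , W-isPath , W-zero , W-verts
      where
      up   = walkUp m≼a
      down = walkUp m≼b

      verts-W : verts D (up ++ʷ reverseʷ down) ≡ startVerts D up ++ reverse (verts D down)
      verts-W = trans (verts-++ʷ up (reverseʷ down)) (cong (startVerts D up ++_) (verts-reverseʷ down))

      W-isPath : IsPath D (up ++ʷ reverseʷ down)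
      W-isPath = subst Unique (sym verts-W) (Uniqueₚ.++⁺ (Unique-startVerts up (walkUp-isPath m≼a))
        (Unique-reverse (walkUp-isPath m≼b))
        λ (y∈up , y∈down) → All.lookup not-below-b y∈up
          (proj₁ (All.lookup (verts-walkUp m≼b) (Anyₚ.reverse⁻ y∈down))))

      up≈down : wt up ≈ wt down
      up≈down = ∙-cancelʳ (potential m) _ _ (begin
        wt up ∙ potential m    ≈⟨ potential-Ancestor m≼a ⟨
        potential a            ≈⟨ same ⟩
        potential b            ≈⟨ potential-Ancestor m≼b ⟩
        wt down ∙ potential m  ∎)

      W-zero : IsZero Γ D γ (up ++ʷ reverseʷ down)
      W-zero = begin
        wt (up ++ʷ reverseʷ down)  ≈⟨ weight-++ʷ Γ γ up (reverseʷ down) ⟩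
        wt up ∙ wt (reverseʷ down) ≈⟨ ∙-cong up≈down (weight-reverseʷ Γ γ down) ⟩
        wt down ∙ wt down ⁻¹       ≈⟨ inverseʳ _ ⟩
        ε                          ∎

      W-verts : All (λ y → Ancestor v y × (Ancestor y a ⊎ Ancestor y b)) (verts D (up ++ʷ reverseʷ down))
      W-verts = subst (All _) (sym verts-W) (Allₚ.++⁺
        (All.map (λ (y≼a , m≼y) → Ancestor-trans m≼y v≼m , inj₁ y≼a)
               (All-startVerts up (verts-walkUp m≼a)))
        (All.tabulate λ y∈ → let (y≼b , m≼y) = All.lookup (verts-walkUp m≼b) (Anyₚ.reverse⁻ y∈) in
          Ancestor-trans m≼y v≼m , inj₂ y≼b))

-- The invariant k·2|Γ| < L + |Γ| on the number L of remaining leaves says (2k-1)|Γ| < L when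
-- k ≥ 1, and holds trivially when k = 0, which is where the induction stops.
budget-start : ∀ {k g L} → 1 ≤ k → (2 * k ∸ 1) * g + 1 ≤ L → k * (g + g) < L + g
budget-start {suc j} {g} {L} _ h = begin-strict
  suc j * (g + g)          ≡⟨ double-suc j g ⟨
  (2 * suc j ∸ 1) * g + g  <⟨ +-monoˡ-< g (subst (_≤ L) (+-comm _ 1) h) ⟩
  L + g                    ∎
  where
  open Data.Nat.Properties.≤-Reasoning
  odd-double : ∀ j g → suc (2 * j) * g + g ≡ suc j * (g + g)
  odd-double = solve-∀
  double-suc : ∀ j g → (2 * suc j ∸ 1) * g + g ≡ suc j * (g + g)
  double-suc j g rewrite +-suc j (j + 0) = odd-double j g

budget-head : ∀ {k g L} → suc k * (g + g) < L + g → g < L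
budget-head {k} {g} {L} h = +-cancelʳ-< g g L (≤-<-trans (m≤m+n (g + g) (k * (g + g))) h)

budget-step : ∀ {k g L L′} → suc k * (g + g) < L + g → L ≤ L′ + (g + g) → k * (g + g) < L′ + g
budget-step {k} {g} {L} {L′} h L≤ = +-cancelˡ-< (g + g) (k * (g + g)) (L′ + g) (begin-strict
  (g + g) + k * (g + g)  <⟨ h ⟩
  L + g                  ≤⟨ +-monoˡ-≤ g L≤ ⟩
  L′ + (g + g) + g       ≡⟨ shuffle L′ g ⟩
  (g + g) + (L′ + g)     ∎)
  where
  open Data.Nat.Properties.≤-Reasoning
  shuffle : ∀ L′ g → L′ + (g + g) + g ≡ (g + g) + (L′ + g)
  shuffle = solve-∀

module ZeroPathPacking {c ℓ : Level} (Γ : FiniteGroup c ℓ) {N M : ℕ} (T : Digraph N M)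
  (γ : Fin M → FiniteGroup.Carrier Γ) (A : Fin N → Set)
  (A⇔leaf : ∀ v → (A v → IsLeaf T v) × (IsLeaf T v → A v))
  (connected : Connected T) (subcubic : Subcubic T) (r : Fin N) (r-leaf : IsLeaf T r) where

  open RootedSpanningTree T connected r
  module Γ = FiniteGroup Γ

  g : ℕ
  g = Γ.order

  1≤g : 1 ≤ g
  1≤g = >-nonZero⁻¹ g {{Fin.nonZeroIndex (proj₁ (Γ.enum-surj Γ.ε))}}

  classOf : Γ.Carrier → Fin g
  classOf x = proj₁ (Γ.enum-surj x)

  classOf-injective : ∀ x y → classOf x ≡ classOf y → x Γ.≈ y
  classOf-injective x y eq = Γ.trans (Γ.sym (proj₂ (Γ.enum-surj x)))
    (Γ.trans (Γ.reflexive (cong Γ.enum eq)) (proj₂ (Γ.enum-surj y)))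

  leaf? : Decidable (IsLeaf T)
  leaf? v = degree T v ≟ℕ 1

  children-bound : ∀ v →
    (IsLeaf T v × length (children v) ≤ 1) ⊎ (¬ IsLeaf T v × length (children v) ≤ 2)
  children-bound v with leaf? v
  ... | yes v-leaf = inj₁ (v-leaf , subst (length (children v) ≤_) v-leaf (children-degree v))
  ... | no  ¬leaf  = inj₂ (¬leaf , s≤s⁻¹ (≤-trans (nonroot-children-degree v v≢r) (subcubic v)))
    where
    v≢r : v ≢ r
    v≢r refl = ¬leaf r-leaf

  -- ds lists the roots of the subtrees discarded so far.
  Removed : List (Fin N) → Fin N → Set
  Removed ds x = Any (λ d → Ancestor d x) ds

  Free : List (Fin N) → Fin N → Set
  Free ds x = IsLeaf T x × ¬ Removed ds x

  free? : ∀ ds → Decidable (Free ds)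
  free? ds x = leaf? x ×-dec ¬? (any? (λ d → ancestor? d x) ds)

  FreeBelow : List (Fin N) → Fin N → Fin N → Set
  FreeBelow ds v x = Free ds x × Ancestor v x

  freeBelow? : ∀ ds v → Decidable (FreeBelow ds v)
  freeBelow? ds v x = free? ds x ×-dec ancestor? v x

  free-count-below-≤ : ∀ ds v → (∀ {c} → Child v c → count (freeBelow? ds c) ≤ g) →
    count (freeBelow? ds v) ≤ g + g
  free-count-below-≤ ds v small-children = begin
    count (freeBelow? ds v)                ≤⟨ count-∪ (freeBelow? ds v) self? below-child? split ⟩
    count self? + count below-child?       ≤⟨ +-monoʳ-≤ (count self?) children-share ⟩
    count self? + length (children v) * g  ≤⟨ bound (children-bound v) ⟩
    g + g                                  ∎
    where
    open Data.Nat.Properties.≤-Reasoning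
    self? : Decidable (λ x → x ≡ v × Free ds x)
    self? x = (x ≟ v) ×-dec free? ds x
    below-child? : Decidable (λ x → Any (λ c → FreeBelow ds c x) (children v))
    below-child? x = any? (λ c → freeBelow? ds c x) (children v)
    children-share : count below-child? ≤ length (children v) * g
    children-share = count-⋃ below-child? (freeBelow? ds) (children v)
      (All.map small-children (children-all v)) id
    split : ∀ {x} → FreeBelow ds v x → (x ≡ v × Free ds x) ⊎ Any (λ c → FreeBelow ds c x) (children v)
    split (free , v≼x) with Ancestor⇒≡⊎below-child v≼x
    ... | inj₁ x≡v     = inj₁ (x≡v , free)
    ... | inj₂ below-c = inj₂ (Any.map (free ,_) below-c)
    bound : (IsLeaf T v × length (children v) ≤ 1) ⊎ (¬ IsLeaf T v × length (children v) ≤ 2) →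
      count self? + length (children v) * g ≤ g + g
    bound (inj₁ (_ , k≤1)) = +-mono-≤
      (≤-trans (count-⊆ self? {xs = [ v ]} λ (x≡v , _) → here x≡v) 1≤g)
      (≤-trans (*-monoˡ-≤ g k≤1) (≤-reflexive (+-identityʳ g)))
    bound (inj₂ (¬leaf , k≤2)) = +-mono-≤
      (count-⊆ self? {xs = []} λ { (refl , leaf , _) → contradiction leaf ¬leaf })
      (≤-trans (*-monoˡ-≤ g k≤2) (≤-reflexive (cong (g +_) (+-identityʳ g))))

  free-count≤below-root : ∀ ds → count (free? ds) ≤ count (freeBelow? ds r)
  free-count≤below-root ds = count-mono (free? ds) (freeBelow? ds r) (_, root-Ancestor _)

  deepest-crowded : ∀ ds → g < count (free? ds) →
    ∃ λ v → g < count (freeBelow? ds v) × (∀ {c} → Child v c → count (freeBelow? ds c) ≤ g)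
  deepest-crowded ds crowded = v , v-crowded , children-uncrowded
    where
    Crowded : Fin N → Set
    Crowded v = g < count (freeBelow? ds v)
    crowded? : Decidable Crowded
    crowded? v = g <? count (freeBelow? ds v)
    v : Fin N
    v = argmax depth r (filter crowded? (allFin N))
    v-crowded : Crowded v
    v-crowded = argmax-all depth (<-≤-trans crowded (free-count≤below-root ds))
      (Allₚ.all-filter crowded? (allFin N))
    children-uncrowded : ∀ {c} → Child v c → count (freeBelow? ds c) ≤ g
    children-uncrowded ch = ≮⇒≥ λ c-crowded → <-irrefl refl (<-≤-trans (Child-depth ch)
      (All.lookup (f[xs]≤f[argmax] {f = depth} r (filter crowded? (allFin N)))
                  (∈-filter-allFin crowded? c-crowded)))

  IsZeroAPath : SomeWalk T → Set ℓ
  IsZeroAPath W = IsAPath T A (SomeWalk.path W) × IsZero Γ T γ (SomeWalk.path W)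

  zero-A-path-below : ∀ ds v → g < count (freeBelow? ds v) →
    Σ (SomeWalk T) λ W → IsZeroAPath W
      × All (λ y → Ancestor v y × ¬ Removed ds y) (verts T (SomeWalk.path W))
  zero-A-path-below ds v crowded
    with a , b , a∈ , b∈ , a≢b , same-class ←
           pigeonhole (Unique-filter-allFin (freeBelow? ds v)) crowded (classOf ∘ potential Γ γ)
    with (a-leaf , a-free) , v≼a ← ∈-filter-allFin⁻ (freeBelow? ds v) a∈
    with (b-leaf , b-free) , v≼b ← ∈-filter-allFin⁻ (freeBelow? ds v) b∈
    with W , W-path , W-zero , W-verts ← zero-path Γ γ v≼a v≼b (classOf-injective _ _ same-class) =
    walk W , (A-path , W-zero) , All.map below-and-free W-verts
    where
    A-path : IsAPath T A W
    A-path = W-path , 1≤len W a≢b , proj₂ (A⇔leaf a) a-leaf , proj₂ (A⇔leaf b) b-leaf ,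
      All.map ends-only (path-interior-degree W W-path)
      where
      ends-only : ∀ {x} → x ≡ a ⊎ x ≡ b ⊎ 2 ≤ degree T x → A x → x ≡ a ⊎ x ≡ b
      ends-only (inj₁ x≡a)          _  = inj₁ x≡a
      ends-only (inj₂ (inj₁ x≡b))   _  = inj₂ x≡b
      ends-only {x} (inj₂ (inj₂ 2≤deg)) Ax = contradiction (proj₁ (A⇔leaf x) Ax) (<⇒≢ 2≤deg ∘ sym)
    below-and-free : ∀ {y} → Ancestor v y × (Ancestor y a ⊎ Ancestor y b) → Ancestor v y × ¬ Removed ds y
    below-and-free (v≼y , inj₁ y≼a) = v≼y , a-free ∘ Any.map (λ d≼y → Ancestor-trans y≼a d≼y)
    below-and-free (v≼y , inj₂ y≼b) = v≼y , b-free ∘ Any.map (λ d≼y → Ancestor-trans y≼b d≼y)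

  free-count-removal : ∀ ds v → count (free? ds) ≤ count (free? (v ∷ ds)) + count (freeBelow? ds v)
  free-count-removal ds v = count-∪ (free? ds) (free? (v ∷ ds)) (freeBelow? ds v) split
    where
    split : ∀ {x} → Free ds x → Free (v ∷ ds) x ⊎ FreeBelow ds v x
    split {x} (leaf , not-removed) with ancestor? v x
    ... | yes v≼x = inj₂ ((leaf , not-removed) , v≼x)
    ... | no  v⋠x = inj₁ (leaf , λ { (here v≼x) → v⋠x v≼x ; (there removed) → not-removed removed })

  record Packing (k : ℕ) (ds : List (Fin N)) : Set ℓ where
    field
      paths    : Fin k → SomeWalk T
      good     : ∀ i → IsZeroAPath (paths i)
      disjoint : ∀ i j → i ≢ j → Disjoint (verts T (SomeWalk.path (paths i)))
                                          (verts T (SomeWalk.path (paths j)))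
      avoids   : ∀ i → All (¬_ ∘ Removed ds) (verts T (SomeWalk.path (paths i)))

  private
    extend : ∀ {k ds v} (W : SomeWalk T) → IsZeroAPath W →
      All (λ y → Ancestor v y × ¬ Removed ds y) (verts T (SomeWalk.path W)) →
      Packing k (v ∷ ds) → Packing (suc k) ds
    extend {k} {ds} {v} W W-good W-below P = record
      { paths = paths′ ; good = good′ ; disjoint = disjoint′ ; avoids = avoids′ }
      where
      open Packing P
      paths′ : Fin (suc k) → SomeWalk T
      paths′ Fin.zero    = W
      paths′ (Fin.suc i) = paths i
      good′ : ∀ i → IsZeroAPath (paths′ i)
      good′ Fin.zero    = W-good
      good′ (Fin.suc i) = good i
      W-disjoint : ∀ i → Disjoint (verts T (SomeWalk.path W)) (verts T (SomeWalk.path (paths i)))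
      W-disjoint i (y∈W , y∈Pᵢ) = All.lookup (avoids i) y∈Pᵢ (here (proj₁ (All.lookup W-below y∈W)))
      disjoint′ : ∀ i j → i ≢ j →
        Disjoint (verts T (SomeWalk.path (paths′ i))) (verts T (SomeWalk.path (paths′ j)))
      disjoint′ Fin.zero    Fin.zero    0≢0 = contradiction refl 0≢0
      disjoint′ Fin.zero    (Fin.suc j) _   = W-disjoint j
      disjoint′ (Fin.suc i) Fin.zero    _   = W-disjoint i ∘ Data.Product.swap
      disjoint′ (Fin.suc i) (Fin.suc j) i≢j = disjoint i j (i≢j ∘ cong Fin.suc)
      avoids′ : ∀ i → All (¬_ ∘ Removed ds) (verts T (SomeWalk.path (paths′ i)))
      avoids′ Fin.zero    = All.map proj₂ W-below
      avoids′ (Fin.suc i) = All.map (_∘ there) (avoids i)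

  packing : ∀ k ds → k * (g + g) < count (free? ds) + g → Packing k ds
  packing zero ds _ = record { paths = λ () ; good = λ () ; disjoint = λ () ; avoids = λ () }
  packing (suc k) ds budget =
    let v , v-crowded , children-uncrowded = deepest-crowded ds (budget-head {k} budget)
        W , W-good , W-below = zero-A-path-below ds v v-crowded
        cost = ≤-trans (free-count-removal ds v) (+-monoʳ-≤ _ (free-count-below-≤ ds v children-uncrowded))
    in extend W W-good W-below (packing k (v ∷ ds) (budget-step {k} budget cost))

lemma2p2 : ∀ {c ℓ : Level} (Γ : FiniteGroup c ℓ) (k : ℕ) → 1 ≤ k →
    ∀ {N M : ℕ} (T : Digraph N M) (γ : Fin M → FiniteGroup.Carrier Γ)
      (A : Fin N → Set) →
    IsATree T A → Subcubic T →
    (2 * k ∸ 1) * FiniteGroup.order Γ + 1 ≤ numLeaves T →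
    Σ (Fin k → SomeWalk T) λ P →
      (∀ i → IsAPath T A (SomeWalk.path (P i))
             × IsZero Γ T γ (SomeWalk.path (P i)))
      × (∀ i j → i ≢ j → Disjoint (verts T (SomeWalk.path (P i)))
                                  (verts T (SomeWalk.path (P j))))
lemma2p2 Γ k 1≤k T γ A ((_ , connected , _) , A⇔leaf) subcubic enough-leaves
  with r , r-leaf ← count-witness (λ v → degree T v ≟ℕ 1) (≤-trans (m≤n+m 1 _) enough-leaves) =
  Packing.paths P , Packing.good P , Packing.disjoint P
  where
  open ZeroPathPacking Γ T γ A A⇔leaf connected subcubic r r-leaf
  P : Packing k []
  P = packing k [] (budget-start 1≤k (≤-trans enough-leaves (count-mono leaf? (free? []) (_, λ ()))))
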